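{- Let $M\in\mathbb{N}$ and let $G$ be a simple graph with no even circuits of length at most $2M$. Then any two distinct odd cycles in $G$ of length at most $M$ are vertex-disjoint.
   Context: A cycle of length $k$ is a collection of edges $\{\{v_1,v_2\},\dots,\{v_{k-1},v_k\},\{v_k,v_1\}\}$ of $G$ with $v_1,\dots,v_k$ distinct vertices. A circuit of length $k$ is a collection of edges of the same form where $v_1,\dots,v_k$ need not be distinct. A cycle/circuit is even or odd according to the parity of $k$. -}

module Defs where

open import Data.Nat using (ℕ; zero; suc; _+_; _*_; _≤_)
open import Data.Nat.DivMod using (_%_; m%n<n)
open import Data.Fin using (Fin; toℕ; fromℕ<)
open import Data.Product using (_×_; ∃; _,_)
open import Data.Sum using (_⊎_)
open import Relation.Binary.PropositionalEquality using (_≡_; _≢_)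
open import Relation.Nullary using (¬_)
open import Function using (_⇔_)
open import Function.Definitions using (Injective)

record SimpleGraph : Set₁ where
  field
    V      : Set
    Adj    : V → V → Set
    sym    : ∀ {x y} → Adj x y → Adj y x
    irrefl : ∀ {x} → ¬ Adj x x

next : ∀ {n} → Fin (suc n) → Fin (suc n)
next {n} i = fromℕ< (m%n<n (suc (toℕ i)) (suc n))

SameEdge : ∀ {V : Set} → V → V → V → V → Set
SameEdge a b c d = (a ≡ c × b ≡ d) ⊎ (a ≡ d × b ≡ c)

Even Odd : ℕ → Set
Even k = ∃ λ m → k ≡ m + m
Odd  k = ∃ λ m → k ≡ suc (m + m)

module _ (G : SimpleGraph) where
  open SimpleGraph G

  record Circuit : Set where
    field
      n      : ℕ
      vert   : Fin (suc n) → V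
      adj    : ∀ i → Adj (vert i) (vert (next i))
      edgesDistinct : ∀ i j →
        SameEdge (vert i) (vert (next i)) (vert j) (vert (next j)) → i ≡ j

    len : ℕ
    len = suc n

  record Cycle : Set where
    field
      circuit  : Circuit
    open Circuit circuit public
    field
      distinct : Injective _≡_ _≡_ vert

  open Circuit

  HasEdge : Circuit → V → V → Set
  HasEdge C a b = ∃ λ i → SameEdge (vert C i) (vert C (next i)) a b

  SameCycle : Cycle → Cycle → Set
  SameCycle C D = ∀ a b → HasEdge (Cycle.circuit C) a b ⇔ HasEdge (Cycle.circuit D) a b

  VertexDisjoint : Cycle → Cycle → Set
  VertexDisjoint C D = ∀ i j → Cycle.vert C i ≢ Cycle.vert D j

  NoEvenCircuitsUpTo : ℕ → Set
  NoEvenCircuitsUpTo L = (C : Circuit) → Even (len C) → ¬ (len C ≤ L)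

-- Suppose the odd cycles C ≠ D share a vertex.  As the goal is ⊥, excluded middle may be used
-- for finitely many propositions, so some edge of one cycle, say D, is not an edge of C.
-- Walking along D through that edge, D leaves C at some vertex and first returns to C at
-- another.  If it returns to a different vertex of C, this ear and one of the two arcs of C
-- between its ends form an even cycle, because the two arcs have odd total length.  If it
-- returns to the same vertex, D meets C only there, and C followed by D is an even closed
-- trail.  Either way there is an even circuit of length at most 2M.

module Submission where

open import Defs
open import Data.Nat
open import Data.Nat.Properties
open import Data.Nat.DivMod
open import Data.Nat.Divisibility using (n∣m*n; ∣-refl)
open import Data.Nat.Tactic.RingSolver using (solve)
open import Data.Fin using (Fin; toℕ) renaming (zero to fzero; suc to fsuc)
open import Data.Fin.Properties using (toℕ-injective; toℕ<n; toℕ-fromℕ<; fromℕ<-cong)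
open import Data.List using (_∷_; [])
open import Data.Product using (∃; _×_; _,_; proj₁; proj₂)
open import Data.Sum using (_⊎_; inj₁; inj₂; [_,_])
open import Data.Empty using (⊥)
open import Effect.Monad using (RawMonad)
open import Function using (_∘_; flip)
open import Function.Bundles using (mk⇔)
open import Level using (0ℓ)
open import Relation.Nullary using (¬_; Dec; yes; no; contradiction)
open import Relation.Nullary.Negation using (¬¬-Monad)
open import Relation.Nullary.Decidable using (¬¬-excluded-middle)
open import Relation.Binary.PropositionalEquality hiding ([_])
open import Relation.Binary.Definitions using (tri<; tri≈; tri>)

open RawMonad (¬¬-Monad {0ℓ}) using (_>>=_; pure)

-- Residues and parity

%-cong-+ˡ : ∀ k {a b n} .{{_ : NonZero n}} → a % n ≡ b % n → (k + a) % n ≡ (k + b) % n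
%-cong-+ˡ k {a} {b} {n} eq = begin
  (k + a) % n             ≡⟨ %-distribˡ-+ k a n ⟩
  (k % n + a % n) % n     ≡⟨ cong (λ x → (k % n + x) % n) eq ⟩
  (k % n + b % n) % n     ≡⟨ %-distribˡ-+ k b n ⟨
  (k + b) % n             ∎
  where open ≡-Reasoning

[1+m%n]%n≡[1+m]%n : ∀ m n .{{_ : NonZero n}} → suc (m % n) % n ≡ suc m % n
[1+m%n]%n≡[1+m]%n m n = %-cong-+ˡ 1 (m%n%n≡m%n m n)

%-cancelʳ-+ : ∀ k {a b} n → (a + k) % suc n ≡ (b + k) % suc n → a % suc n ≡ b % suc n
%-cancelʳ-+ k {a} {b} n eq = begin
  a % suc n                   ≡⟨ unshift a ⟨
  (k * n + (a + k)) % suc n   ≡⟨ %-cong-+ˡ (k * n) eq ⟩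
  (k * n + (b + k)) % suc n   ≡⟨ unshift b ⟩
  b % suc n                   ∎
  where
  open ≡-Reasoning
  regroup : ∀ x → k * n + (x + k) ≡ x + k * suc n
  regroup x = solve (k ∷ n ∷ x ∷ [])
  unshift : ∀ x → (k * n + (x + k)) % suc n ≡ x % suc n
  unshift x = trans (%-congˡ (regroup x)) (%-remove-+ʳ x (n∣m*n k))

+-%-injectiveˡ : ∀ k {a b n} → a < suc n → b < suc n → (a + k) % suc n ≡ (b + k) % suc n → a ≡ b
+-%-injectiveˡ k {a} {b} {n} a<n b<n eq =
  trans (sym (m<n⇒m%n≡m a<n)) (trans (%-cancelʳ-+ k {a} {b} n eq) (m<n⇒m%n≡m b<n))

3≤+ : ∀ {p q} → 0 < p → 0 < q → (p ≡ 1 → q ≢ 1) → 3 ≤ p + q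
3≤+ {1}           {1}           _ _ ≢ = contradiction refl (≢ refl)
3≤+ {1}           {suc (suc _)} _ _ _ = s≤s (s≤s (s≤s z≤n))
3≤+ {suc (suc p)} {suc q}       _ _ _ = s≤s (s≤s (≤-trans (s≤s z≤n) (m≤n+m (suc q) p)))

+-≤-2* : ∀ {m n M} → m ≤ M → n ≤ M → m + n ≤ 2 * M
+-≤-2* {m} {n} {M} m≤M n≤M = subst (m + n ≤_) (cong (M +_) (sym (+-identityʳ M))) (+-mono-≤ m≤M n≤M)

even⊎odd : ∀ n → Even n ⊎ Odd n
even⊎odd zero = inj₁ (0 , refl)
even⊎odd (suc n) with even⊎odd n
... | inj₁ (m , refl) = inj₂ (m , refl)
... | inj₂ (m , refl) = inj₁ (suc m , cong suc (sym (+-suc m m)))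

m+m≢1+[k+k] : ∀ m k → m + m ≢ suc (k + k)
m+m≢1+[k+k] (suc m) zero eq = 1+n≢0 (trans (sym (+-suc m m)) (suc-injective eq))
m+m≢1+[k+k] (suc m) (suc k) eq =
  m+m≢1+[k+k] m k (suc-injective (trans (sym (+-suc m m)) (trans (suc-injective eq) (cong suc (+-suc k k)))))

even⇒¬odd : ∀ {n} → Even n → ¬ Odd n
even⇒¬odd (m , refl) (k , eq) = m+m≢1+[k+k] m k eq

odd+odd⇒even : ∀ {m n} → Odd m → Odd n → Even (m + n)
odd+odd⇒even (k , refl) (l , refl) = suc (k + l) , solve (k ∷ l ∷ [])

even-+ˡ⊎even-+ʳ : ∀ p {q₁ q₂} → Odd (q₁ + q₂) → Even (p + q₁) ⊎ Even (p + q₂)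
even-+ˡ⊎even-+ʳ p {q₁} {q₂} (k , eq) with even⊎odd (p + q₁) | even⊎odd (p + q₂)
... | inj₁ e₁ | _      = inj₁ e₁
... | inj₂ _  | inj₁ e₂ = inj₂ e₂
... | inj₂ o₁ | inj₂ o₂ = contradiction (p + k , sumOdd) (even⇒¬odd (odd+odd⇒even o₁ o₂))
  where
  sumOdd : (p + q₁) + (p + q₂) ≡ suc ((p + k) + (p + k))
  sumOdd = begin
    (p + q₁) + (p + q₂)  ≡⟨ solve (p ∷ q₁ ∷ q₂ ∷ []) ⟩
    (p + p) + (q₁ + q₂)  ≡⟨ cong (p + p +_) eq ⟩
    (p + p) + suc (k + k) ≡⟨ solve (p ∷ k ∷ []) ⟩
    suc ((p + k) + (p + k)) ∎
    where open ≡-Reasoning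

-- Double negation and bounded search

¬¬-decidableUpTo : ∀ (P : ℕ → Set) n → ¬ ¬ (∀ t → t ≤ n → Dec (P t))
¬¬-decidableUpTo P zero = do
  d ← ¬¬-excluded-middle
  pure λ { .zero z≤n → d }
¬¬-decidableUpTo P (suc n) = do
  decs ← ¬¬-decidableUpTo P n
  d ← ¬¬-excluded-middle
  pure λ t t≤1+n → [ (λ t<1+n → decs t (s≤s⁻¹ t<1+n)) , (λ { refl → d }) ] (m≤n⇒m<n∨m≡n t≤1+n)

¬¬-∀-Fin : ∀ {n} {P : Fin n → Set} → (∀ i → ¬ ¬ P i) → ¬ ¬ (∀ i → P i)
¬¬-∀-Fin {zero} _ = pure λ ()
¬¬-∀-Fin {suc n} ¬¬P = do
  P₀ ← ¬¬P fzero
  Pₛ ← ¬¬-∀-Fin (¬¬P ∘ fsuc)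
  pure λ { fzero → P₀ ; (fsuc i) → Pₛ i }

module _ {P : ℕ → Set} where

  greatestUpTo : ∀ {lo k} → (∀ t → t ≤ k → Dec (P t)) → lo ≤′ k → P lo →
                 ∃ λ a → lo ≤ a × a ≤ k × P a × (∀ {t} → a < t → t ≤ k → ¬ P t)
  greatestUpTo dec ≤′-refl Plo = _ , ≤-refl , ≤-refl , Plo , λ a<t t≤a → contradiction t≤a (<⇒≱ a<t)
  greatestUpTo {k = suc k} dec (≤′-step lo≤′k) Plo with dec (suc k) ≤-refl
  ... | yes P[1+k] = suc k , ≤′⇒≤ (≤′-step lo≤′k) , ≤-refl , P[1+k] , λ k<t t≤k → contradiction t≤k (<⇒≱ k<t)
  ... | no ¬P[1+k] with greatestUpTo (λ t t≤k → dec t (m≤n⇒m≤1+n t≤k)) lo≤′k Plo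
  ... | a , lo≤a , a≤k , Pa , above =
    a , lo≤a , m≤n⇒m≤1+n a≤k , Pa ,
    λ a<t t≤1+k → [ above a<t ∘ s≤s⁻¹ , (λ { refl → ¬P[1+k] }) ] (m≤n⇒m<n∨m≡n t≤1+k)

  leastFrom : ∀ {lo hi} → (∀ t → t ≤ hi → Dec (P t)) → lo ≤‴ hi → P hi →
              ∃ λ b → lo ≤ b × b ≤ hi × P b × (∀ {t} → lo ≤ t → t < b → ¬ P t)
  leastFrom dec ≤‴-refl Phi = _ , ≤-refl , ≤-refl , Phi , λ lo≤t t<lo → contradiction lo≤t (<⇒≱ t<lo)
  leastFrom {lo} dec (≤‴-step 1+lo≤‴hi) Phi with dec lo (<⇒≤ (≤‴⇒≤ 1+lo≤‴hi))
  ... | yes Plo = lo , ≤-refl , <⇒≤ (≤‴⇒≤ 1+lo≤‴hi) , Plo , λ lo≤t t<lo → contradiction lo≤t (<⇒≱ t<lo)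
  ... | no ¬Plo with leastFrom dec 1+lo≤‴hi Phi
  ... | b , 1+lo≤b , b≤hi , Pb , below =
    b , <⇒≤ 1+lo≤b , b≤hi , Pb ,
    λ lo≤t t<b → [ (λ lo<t → below lo<t t<b) , (λ { refl → ¬Plo }) ] (m≤n⇒m<n∨m≡n lo≤t)

  record Gap (lo k hi : ℕ) : Set where
    field
      start end  : ℕ
      lo≤start   : lo ≤ start
      start≤k    : start ≤ k
      k<end      : k < end
      end≤hi     : end ≤ hi
      P-start    : P start
      P-end      : P end
      ¬P-between : ∀ {t} → start < t → t < end → ¬ P t

  gap : ∀ {lo k hi} → (∀ t → t ≤ hi → Dec (P t)) → lo ≤ k → k < hi → P lo → P hi → Gap lo k hi
  gap {k = k} dec lo≤k k<hi Plo Phi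
    with greatestUpTo (λ t t≤k → dec t (≤-trans t≤k (<⇒≤ k<hi))) (≤⇒≤′ lo≤k) Plo
       | leastFrom dec (≤⇒≤‴ k<hi) Phi
  ... | a , lo≤a , a≤k , Pa , above | b , k<b , b≤hi , Pb , below = record
    { start = a ; end = b ; lo≤start = lo≤a ; start≤k = a≤k ; k<end = k<b ; end≤hi = b≤hi
    ; P-start = Pa ; P-end = Pb
    ; ¬P-between = λ {t} a<t t<b → [ above a<t , (λ k<t → below k<t t<b) ] (≤-<-connex t k)
    }

-- Sequences of vertices

module _ {V : Set} where

  SameEdge-cong : ∀ {a a′ b b′ c c′ d d′ : V} → a ≡ a′ → b ≡ b′ → c ≡ c′ → d ≡ d′ →
                  SameEdge a b c d → SameEdge a′ b′ c′ d′
  SameEdge-cong refl refl refl refl e = e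

  SameEdge-sym : ∀ {a b c d : V} → SameEdge a b c d → SameEdge c d a b
  SameEdge-sym (inj₁ (refl , refl)) = inj₁ (refl , refl)
  SameEdge-sym (inj₂ (refl , refl)) = inj₂ (refl , refl)

  SameEdge-swapʳ : ∀ {a b c d : V} → SameEdge a b c d → SameEdge a b d c
  SameEdge-swapʳ (inj₁ e) = inj₂ e
  SameEdge-swapʳ (inj₂ e) = inj₁ e

  SameEdge-trans : ∀ {a b c d e f : V} → SameEdge a b c d → SameEdge c d e f → SameEdge a b e f
  SameEdge-trans (inj₁ (refl , refl)) e = e
  SameEdge-trans (inj₂ (refl , refl)) e = SameEdge-sym (SameEdge-swapʳ (SameEdge-sym e))

  SameEdge-endpoints : ∀ {a b c d : V} → SameEdge a b c d → (c ≡ a ⊎ c ≡ b) × (d ≡ a ⊎ d ≡ b)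
  SameEdge-endpoints (inj₁ (refl , refl)) = inj₁ refl , inj₂ refl
  SameEdge-endpoints (inj₂ (refl , refl)) = inj₂ refl , inj₁ refl

  InjectiveBelow : ℕ → (ℕ → V) → Set
  InjectiveBelow L h = ∀ {r r′} → r < L → r′ < L → h r ≡ h r′ → r ≡ r′

  EdgeInjectiveBelow : ℕ → (ℕ → V) → Set
  EdgeInjectiveBelow L h = ∀ {r r′} → r < L → r′ < L →
    SameEdge (h r) (h (suc r)) (h r′) (h (suc r′)) → r ≡ r′

  closed-% : ∀ {n} {h : ℕ → V} → h (suc n) ≡ h 0 → ∀ {r} → r ≤ suc n → h (r % suc n) ≡ h r
  closed-% {n} {h} closed r≤ with m≤n⇒m<n∨m≡n r≤
  ... | inj₁ r<  = cong h (m<n⇒m%n≡m r<)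
  ... | inj₂ refl = trans (cong h (n%n≡0 (suc n))) (sym closed)

  -- In a closed path of length L, two edges with opposite orientation would give r ≡ r + 2 (mod L).
  closedPath⇒edgeInjective : ∀ {L} {h : ℕ → V} → 3 ≤ L → h L ≡ h 0 →
                             InjectiveBelow L h → EdgeInjectiveBelow L h
  closedPath⇒edgeInjective _ _ inj r< r′< (inj₁ (eq , _)) = inj r< r′< eq
  closedPath⇒edgeInjective {suc n} {h} 3≤L closed inj {r} {r′} r< r′< (inj₂ (e₁ , e₂)) =
    contradiction (+-%-injectiveˡ r 3≤L (s≤s z≤n) r+2≡r+0) λ ()
    where
    wrap : ∀ {x} → x < suc n → h (suc x) ≡ h (suc x % suc n)
    wrap x< = sym (closed-% {h = h} closed x<)
    r≡[1+r′] : r ≡ suc r′ % suc n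
    r≡[1+r′] = inj r< (m%n<n (suc r′) (suc n)) (trans e₁ (wrap r′<))
    [1+r]≡r′ : suc r % suc n ≡ r′
    [1+r]≡r′ = inj (m%n<n (suc r) (suc n)) r′< (trans (sym (wrap r<)) e₂)
    r+2≡r+0 : (2 + r) % suc n ≡ (0 + r) % suc n
    r+2≡r+0 = begin
      suc (suc r) % suc n          ≡⟨ [1+m%n]%n≡[1+m]%n (suc r) (suc n) ⟨
      suc (suc r % suc n) % suc n  ≡⟨ cong (λ x → suc x % suc n) [1+r]≡r′ ⟩
      suc r′ % suc n               ≡⟨ r≡[1+r′] ⟨
      r                            ≡⟨ m<n⇒m%n≡m r< ⟨
      r % suc n                    ∎
      where open ≡-Reasoning

data Split (p q : ℕ) : ℕ → Set where
  left  : ∀ {r} → r < p → Split p q r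
  right : ∀ {s} → s < q → Split p q (p + s)

split : ∀ p {q r} → r < p + q → Split p q r
split p {q} {r} r<p+q with r <? p
... | yes r<p = left r<p
... | no  r≮p = subst (Split p q) (m+[n∸m]≡n p≤r) (right r∸p<q)
  where
  p≤r : p ≤ r
  p≤r = ≮⇒≥ r≮p
  r∸p<q : r ∸ p < q
  r∸p<q = subst (r ∸ p <_) (m+n∸m≡n p q) (∸-monoˡ-< r<p+q p≤r)

module _ {A : Set} where

  infixr 5 _++⟨_⟩_

  opaque
    _++⟨_⟩_ : (ℕ → A) → ℕ → (ℕ → A) → ℕ → A
    (f ++⟨ p ⟩ g) r with r <? p
    ... | yes _ = f r
    ... | no  _ = g (r ∸ p)

    ++-< : ∀ {f g : ℕ → A} {p r} → r < p → (f ++⟨ p ⟩ g) r ≡ f r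
    ++-< {p = p} {r} r<p with r <? p
    ... | yes _   = refl
    ... | no  r≮p = contradiction r<p r≮p

    ++-+ : ∀ {f g : ℕ → A} {p} s → (f ++⟨ p ⟩ g) (p + s) ≡ g s
    ++-+ {g = g} {p} s with p + s <? p
    ... | yes p+s<p = contradiction (m≤m+n p s) (<⇒≱ p+s<p)
    ... | no  _     = cong g (m+n∸m≡n p s)

  module _ {f g : ℕ → A} {p : ℕ} where

    ++-suc-< : f p ≡ g 0 → ∀ {r} → r < p → (f ++⟨ p ⟩ g) (suc r) ≡ f (suc r)
    ++-suc-< fp≡g0 {r} r<p with m≤n⇒m<n∨m≡n r<p
    ... | inj₁ 1+r<p = ++-< 1+r<p
    ... | inj₂ refl  = trans (cong (f ++⟨ p ⟩ g) (sym (+-identityʳ p))) (trans (++-+ 0) (sym fp≡g0))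

    ++-suc-+ : ∀ s → (f ++⟨ p ⟩ g) (suc (p + s)) ≡ g (suc s)
    ++-suc-+ s = trans (cong (f ++⟨ p ⟩ g) (sym (+-suc p s))) (++-+ (suc s))

    ++-closed : ∀ {q} → 0 < p → f 0 ≡ g q → (f ++⟨ p ⟩ g) (p + q) ≡ (f ++⟨ p ⟩ g) 0
    ++-closed {q} 0<p f0≡gq = trans (++-+ q) (trans (sym f0≡gq) (sym (++-< 0<p)))

    ++-injective : ∀ {q} → InjectiveBelow p f → InjectiveBelow q g →
                   (∀ {r s} → r < p → s < q → f r ≢ g s) → InjectiveBelow (p + q) (f ++⟨ p ⟩ g)
    ++-injective {q} injf injg disjoint r< r′< eq with split p r< | split p r′<
    ... | left a  | left b  = injf a b (trans (sym (++-< a)) (trans eq (++-< b)))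
    ... | left a  | right s = contradiction (trans (sym (++-< a)) (trans eq (++-+ _))) (disjoint a s)
    ... | right s | left b  = contradiction (trans (sym (++-< b)) (trans (sym eq) (++-+ _))) (disjoint b s)
    ... | right s | right t = cong (p +_) (injg s t (trans (sym (++-+ _)) (trans eq (++-+ _))))

    ++-edgeInjective : ∀ {q} → f p ≡ g 0 → EdgeInjectiveBelow p f → EdgeInjectiveBelow q g →
                       (∀ {r s} → r < p → s < q → ¬ SameEdge (f r) (f (suc r)) (g s) (g (suc s))) →
                       EdgeInjectiveBelow (p + q) (f ++⟨ p ⟩ g)
    ++-edgeInjective {q} fp≡g0 injf injg disjoint r< r′< e with split p r< | split p r′<
    ... | left a  | left b  = injf a b (SameEdge-cong (++-< a) (++-suc-< fp≡g0 a) (++-< b) (++-suc-< fp≡g0 b) e)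
    ... | left a  | right s = contradiction (SameEdge-cong (++-< a) (++-suc-< fp≡g0 a) (++-+ _) (++-suc-+ _) e) (disjoint a s)
    ... | right s | left b  =
      contradiction (SameEdge-sym (SameEdge-cong (++-+ _) (++-suc-+ _) (++-< b) (++-suc-< fp≡g0 b) e)) (disjoint b s)
    ... | right s | right t = cong (p +_) (injg s t (SameEdge-cong (++-+ _) (++-suc-+ _) (++-+ _) (++-suc-+ _) e))

  reverse : ℕ → (ℕ → A) → ℕ → A
  reverse p π r = π (p ∸ r)

module _ (G : SimpleGraph) where
  open SimpleGraph G renaming (sym to Adj-sym)

  IsWalk : ℕ → (ℕ → V) → Set
  IsWalk L h = ∀ {r} → r < L → Adj (h r) (h (suc r))

  record IsClosedTrail (L : ℕ) (h : ℕ → V) : Set where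
    field
      closed        : h L ≡ h 0
      walk          : IsWalk L h
      edgeInjective : EdgeInjectiveBelow L h

  ++-walk : ∀ {f g : ℕ → V} {p q} → f p ≡ g 0 → IsWalk p f → IsWalk q g → IsWalk (p + q) (f ++⟨ p ⟩ g)
  ++-walk {f} {g} {p} fp≡g0 walkf walkg r< with split p r<
  ... | left a  = subst₂ Adj (sym (++-< a)) (sym (++-suc-< fp≡g0 a)) (walkf a)
  ... | right {s} s<q = subst₂ Adj (sym (++-+ {f = f} s)) (sym (++-suc-+ {f = f} s)) (walkg s<q)

  closedTrail⇒circuit : ∀ {L h} → 0 < L → IsClosedTrail L h → ∃ λ (C : Circuit G) → Circuit.len C ≡ L
  closedTrail⇒circuit {suc n} {h} _ trail = circuit , refl
    where
    open IsClosedTrail trail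
    h-next : ∀ (i : Fin (suc n)) → h (toℕ (next i)) ≡ h (suc (toℕ i))
    h-next i = trans (cong h (toℕ-fromℕ< _)) (closed-% {h = h} closed (toℕ<n i))
    circuit : Circuit G
    circuit = record
      { n             = n
      ; vert          = h ∘ toℕ
      ; adj           = λ i → subst (Adj _) (sym (h-next i)) (walk (toℕ<n i))
      ; edgesDistinct = λ i j e → toℕ-injective (edgeInjective (toℕ<n i) (toℕ<n j)
                          (SameEdge-cong refl (h-next i) refl (h-next j) e))
      }

  3≤len : (C : Circuit G) → 3 ≤ Circuit.len C
  3≤len record { n = zero ; adj = adj } = contradiction (adj fzero) irrefl
  3≤len record { n = suc zero ; edgesDistinct = edgesDistinct }
    with edgesDistinct fzero (fsuc fzero) (inj₂ (refl , refl))
  ... | ()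
  3≤len record { n = suc (suc _) } = s≤s (s≤s (s≤s z≤n))

  -- Cycles as periodic sequences

  -- `at C` unrolls the cycle C into a sequence of period `len C`.  Like `_++⟨_⟩_` it is opaque,
  -- so that unification sees `at C u` rather than a stuck `_%_` computation.
  opaque
    at : Cycle G → ℕ → V
    at C u = Cycle.vert C (u mod Cycle.len C)

  OnCycle : Cycle G → V → Set
  OnCycle C v = ∃ λ m → v ≡ at C m

  module _ (C : Cycle G) where
    open Cycle C

    opaque
      unfolding at

      private
        mod-cong : ∀ u v → u % len ≡ v % len → u mod len ≡ v mod len
        mod-cong u v eq = fromℕ<-cong _ _ eq _ _

        toℕ-mod : ∀ u → toℕ (u mod len) ≡ u % len
        toℕ-mod u = toℕ-fromℕ< _

        next-mod : ∀ u → next (u mod len) ≡ suc u mod len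
        next-mod u = mod-cong (suc (toℕ (u mod len))) (suc u) (trans (cong (λ x → suc x % len) (toℕ-mod u)) ([1+m%n]%n≡[1+m]%n u len))

        mod-injective : ∀ {lo a b} → a < len → b < len → (a + lo) mod len ≡ (b + lo) mod len → a ≡ b
        mod-injective {lo} {a} {b} a< b< eq =
          +-%-injectiveˡ lo a< b< (trans (sym (toℕ-mod (a + lo))) (trans (cong toℕ eq) (toℕ-mod (b + lo))))

        toℕ-mod-len : ∀ i → toℕ i mod len ≡ i
        toℕ-mod-len i = toℕ-injective (trans (toℕ-mod (toℕ i)) (m<n⇒m%n≡m (toℕ<n i)))

      at-periodic : ∀ u → at C (len + u) ≡ at C u
      at-periodic u = cong vert (mod-cong (len + u) u (%-remove-+ˡ u ∣-refl))

      at-% : ∀ u → at C (u % len) ≡ at C u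
      at-% u = cong vert (mod-cong (u % len) u (m%n%n≡m%n u len))

      at-suc : ∀ u → vert (next (u mod len)) ≡ at C (suc u)
      at-suc u = cong vert (next-mod u)

      at-adj : ∀ u → Adj (at C u) (at C (suc u))
      at-adj u = subst (Adj (at C u)) (at-suc u) (adj (u mod len))

      at-hasEdge : ∀ u → HasEdge G circuit (at C u) (at C (suc u))
      at-hasEdge u = u mod len , inj₁ (refl , at-suc u)

      at-injective : ∀ {lo a b} → a < len → b < len → at C (a + lo) ≡ at C (b + lo) → a ≡ b
      at-injective a< b< = mod-injective a< b< ∘ distinct

      at-edgeInjective : ∀ {lo a b} → a < len → b < len →
        SameEdge (at C (a + lo)) (at C (suc (a + lo))) (at C (b + lo)) (at C (suc (b + lo))) → a ≡ b
      at-edgeInjective a< b< e =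
        mod-injective a< b< (edgesDistinct _ _ (SameEdge-cong refl (sym (at-suc _)) refl (sym (at-suc _)) e))

      at-toℕ : ∀ i → at C (toℕ i) ≡ vert i
      at-toℕ i = cong vert (toℕ-mod-len i)

      at-suc-toℕ : ∀ i → at C (suc (toℕ i)) ≡ vert (next i)
      at-suc-toℕ i = trans (sym (at-suc (toℕ i))) (cong (vert ∘ next) (toℕ-mod-len i))

      onCycle-bounded : ∀ {v} → OnCycle C v → ∃ λ i → i < len × v ≡ at C i
      onCycle-bounded (m , eq) = m % len , m%n<n m len , trans eq (sym (at-% m))

      at-repeat⇒len≤ : ∀ {a b} → a < b → at C a ≡ at C b → len + a ≤ b
      at-repeat⇒len≤ {a} {b} a<b eq = subst (len + a ≤_) [b∸a]+a≡b (+-monoˡ-≤ a (≮⇒≥ b∸a≮len))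
        where
        [b∸a]+a≡b : b ∸ a + a ≡ b
        [b∸a]+a≡b = m∸n+n≡m (<⇒≤ a<b)
        b∸a≮len : b ∸ a ≮ len
        b∸a≮len b∸a<len = <⇒≢ (m<n⇒0<n∸m a<b)
          (at-injective z<s b∸a<len (trans eq (cong (at C) (sym [b∸a]+a≡b))))

  -- Ears, arcs and figure eights

  atFrom : Cycle G → ℕ → ℕ → V
  atFrom C j s = at C (s + j)

  HasEdge-swap : ∀ {C a b} → HasEdge G C a b → HasEdge G C b a
  HasEdge-swap (i , e) = i , SameEdge-swapʳ e

  record Arcs (X : Cycle G) (i j : ℕ) : Set where
    field
      q₁ q₂     : ℕ
      0<q₁      : 0 < q₁
      0<q₂      : 0 < q₂
      q₁+q₂≡len : q₁ + q₂ ≡ Cycle.len X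
      j→i       : at X (q₁ + j) ≡ at X i
      i→j       : at X (q₂ + i) ≡ at X j

    q₁<len : q₁ < Cycle.len X
    q₁<len = subst (q₁ <_) q₁+q₂≡len (m<m+n q₁ 0<q₂)

    q₂<len : q₂ < Cycle.len X
    q₂<len = subst (q₂ <_) (trans (+-comm q₂ q₁) q₁+q₂≡len) (m<m+n q₂ 0<q₁)

  Arcs-sym : ∀ {X i j} → Arcs X i j → Arcs X j i
  Arcs-sym a = record
    { q₁ = q₂ ; q₂ = q₁ ; 0<q₁ = 0<q₂ ; 0<q₂ = 0<q₁
    ; q₁+q₂≡len = trans (+-comm q₂ q₁) q₁+q₂≡len ; j→i = i→j ; i→j = j→i }
    where open Arcs a

  module _ (X : Cycle G) where
    open Cycle X using (len)

    arcs-> : ∀ {i j} → j < i → i < len → Arcs X i j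
    arcs-> {i} {j} j<i i<len = record
      { q₁ = i ∸ j ; q₂ = len ∸ (i ∸ j)
      ; 0<q₁ = m<n⇒0<n∸m j<i ; 0<q₂ = m<n⇒0<n∸m i∸j<len
      ; q₁+q₂≡len = m+[n∸m]≡n (<⇒≤ i∸j<len)
      ; j→i = cong (at X) (m∸n+n≡m (<⇒≤ j<i))
      ; i→j = trans (cong (at X) around) (at-periodic X j)
      }
      where
      i∸j<len : i ∸ j < len
      i∸j<len = ≤-<-trans (m∸n≤m i j) i<len
      around : len ∸ (i ∸ j) + i ≡ len + j
      around = begin
        len ∸ (i ∸ j) + i            ≡⟨ cong (len ∸ (i ∸ j) +_) (m∸n+n≡m (<⇒≤ j<i)) ⟨
        len ∸ (i ∸ j) + (i ∸ j + j)  ≡⟨ +-assoc (len ∸ (i ∸ j)) (i ∸ j) j ⟨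
        len ∸ (i ∸ j) + (i ∸ j) + j  ≡⟨ cong (_+ j) (m∸n+n≡m (<⇒≤ i∸j<len)) ⟩
        len + j                      ∎
        where open ≡-Reasoning

    arcs : ∀ {i j} → i < len → j < len → i ≢ j → Arcs X i j
    arcs {i} {j} i< j< i≢j with <-cmp i j
    ... | tri< i<j _ _ = Arcs-sym (arcs-> i<j j<)
    ... | tri≈ _ i≡j _ = contradiction i≡j i≢j
    ... | tri> _ _ j<i = arcs-> j<i i<

  -- A path whose inner vertices avoid X. It must not be a single edge of X: closed up by that
  -- same edge it would only give a back-and-forth walk of length 2.
  record Ear (X : Cycle G) (p : ℕ) (π : ℕ → V) : Set where
    field
      walk              : IsWalk p π
      interiorInjective : ∀ {r r′} → 0 < r → r < p → 0 < r′ → r′ < p → π r ≡ π r′ → r ≡ r′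
      interiorOff       : ∀ {r} → 0 < r → r < p → ¬ OnCycle X (π r)
      notChord          : p ≡ 1 → ¬ HasEdge G (Cycle.circuit X) (π 0) (π 1)

  Ear-reverse : ∀ {X p π} → Ear X p π → Ear X p (reverse p π)
  Ear-reverse {X} {p} {π} ear = record
    { walk              = λ {r} r<p → subst (λ x → Adj (π x) (π (p ∸ suc r))) (sym (+-∸-assoc 1 r<p))
                                        (Adj-sym (walk (∸-monoʳ-< z<s r<p)))
    ; interiorInjective = λ 0<r r<p 0<r′ r′<p eq → ∸-cancelˡ-≡ (<⇒≤ r<p) (<⇒≤ r′<p)
                            (interiorInjective (m<n⇒0<n∸m r<p) (mirror 0<r r<p) (m<n⇒0<n∸m r′<p) (mirror 0<r′ r′<p) eq)
    ; interiorOff       = λ 0<r r<p → interiorOff (m<n⇒0<n∸m r<p) (mirror 0<r r<p)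
    ; notChord          = λ { refl → notChord refl ∘ HasEdge-swap {Cycle.circuit X} }
    }
    where
    open Ear ear
    mirror : ∀ {r} → 0 < r → r < p → p ∸ r < p
    mirror 0<r r<p = ∸-monoʳ-< 0<r (<⇒≤ r<p)

  ear+arc⇒closedTrail : ∀ {X p π j q} → Ear X p π → 0 < p → 0 < q → q < Cycle.len X →
                        π 0 ≡ at X (q + j) → π p ≡ at X j → IsClosedTrail (p + q) (π ++⟨ p ⟩ atFrom X j)
  ear+arc⇒closedTrail {X} {p} {π} {j} {q} ear 0<p 0<q q<len start end = record
    { closed        = ++-closed 0<p start
    ; walk          = ++-walk end walk (λ {s} _ → at-adj X (s + j))
    ; edgeInjective = closedPath⇒edgeInjective 3≤p+q (++-closed 0<p start)
                        (++-injective π-injective arc-injective disjoint)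
    }
    where
    open Ear ear
    π-injective : InjectiveBelow p π
    π-injective {zero}  {zero}   _  _   _  = refl
    π-injective {zero}  {suc _}  _  r′< eq = contradiction (q + j , trans (sym eq) start) (interiorOff z<s r′<)
    π-injective {suc _} {zero}   r< _   eq = contradiction (q + j , trans eq start) (interiorOff z<s r<)
    π-injective {suc _} {suc _}  r< r′< eq = interiorInjective z<s r< z<s r′< eq
    arc-injective : InjectiveBelow q (atFrom X j)
    arc-injective s< t< = at-injective X (<-trans s< q<len) (<-trans t< q<len)
    disjoint : ∀ {r s} → r < p → s < q → π r ≢ atFrom X j s
    disjoint {zero}  _   s<q eq = <⇒≢ s<q (sym (at-injective X q<len (<-trans s<q q<len) (trans (sym start) eq)))
    disjoint {suc _} r<p _   eq = interiorOff z<s r<p (_ , eq)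
    3≤p+q : 3 ≤ p + q
    3≤p+q = 3≤+ 0<p 0<q λ { refl refl →
      notChord refl (HasEdge-swap {Cycle.circuit X} (subst₂ (HasEdge G (Cycle.circuit X)) (sym end) (sym start) (at-hasEdge X j))) }

  figureEight : ∀ {X Y : Cycle G} {i s} → at Y s ≡ at X i →
                (∀ {t} → 0 < t → t < Cycle.len Y → ¬ OnCycle X (at Y (t + s))) →
                IsClosedTrail (Cycle.len X + Cycle.len Y) (atFrom X i ++⟨ Cycle.len X ⟩ atFrom Y s)
  figureEight {X} {Y} {i} {s} meet apart = record
    { closed        = ++-closed z<s (trans (sym meet) (sym (at-periodic Y s)))
    ; walk          = ++-walk junction (λ {r} _ → at-adj X (r + i)) (λ {t} _ → at-adj Y (t + s))
    ; edgeInjective = ++-edgeInjective junction (at-edgeInjective X) (at-edgeInjective Y) disjoint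
    }
    where
    junction : at X (Cycle.len X + i) ≡ at Y s
    junction = trans (at-periodic X i) (sym meet)
    onX : ∀ {v a b} → v ≡ at X a ⊎ v ≡ at X b → OnCycle X v
    onX = [ (_ ,_) , (_ ,_) ]
    -- every edge of Y has an end off X; for the first edge this needs 3 ≤ len Y
    disjoint : ∀ {r t} → r < Cycle.len X → t < Cycle.len Y →
               ¬ SameEdge (at X (r + i)) (at X (suc r + i)) (at Y (t + s)) (at Y (suc t + s))
    disjoint {t = zero}  _ _  e = apart z<s (<-≤-trans (s≤s (s≤s z≤n)) (3≤len (Cycle.circuit Y)))
                                    (onX (proj₂ (SameEdge-endpoints e)))
    disjoint {t = suc _} _ t< e = apart z<s t< (onX (proj₁ (SameEdge-endpoints e)))

  -- Even closed trails from two odd cycles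

  module _ (M : ℕ) (noEven : NoEvenCircuitsUpTo G (2 * M)) where

    noShortEvenClosedTrail : ∀ {L h} → 0 < L → IsClosedTrail L h → Even L → L ≤ 2 * M → ⊥
    noShortEvenClosedTrail 0<L trail even L≤2M with closedTrail⇒circuit 0<L trail
    ... | C , refl = noEven C even L≤2M

    module _ (X : Cycle G) (oddX : Odd (Cycle.len X)) (X≤M : Cycle.len X ≤ M) where

      -- Of the two arcs of X between the ends of the ear, one closes it into an even cycle.
      ear⇒⊥ : ∀ {p π} → Ear X p π → 0 < p → p ≤ M →
              OnCycle X (π 0) → OnCycle X (π p) → π 0 ≢ π p → ⊥
      ear⇒⊥ {p} {π} ear 0<p p≤M start end π0≢πp
        with onCycle-bounded X start | onCycle-bounded X end
      ... | i , i<len , π0≡i | j , j<len , πp≡j =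
        [ close₁ , close₂ ] (even-+ˡ⊎even-+ʳ p (subst Odd (sym q₁+q₂≡len) oddX))
        where
        open Arcs (arcs X i<len j<len λ i≡j → π0≢πp (trans π0≡i (trans (cong (at X) i≡j) (sym πp≡j))))
        close₁ : Even (p + q₁) → ⊥
        close₁ even = noShortEvenClosedTrail (<-≤-trans 0<p (m≤m+n p q₁))
          (ear+arc⇒closedTrail ear 0<p 0<q₁ q₁<len (trans π0≡i (sym j→i)) πp≡j)
          even (+-≤-2* p≤M (≤-trans (<⇒≤ q₁<len) X≤M))
        close₂ : Even (p + q₂) → ⊥
        close₂ even = noShortEvenClosedTrail (<-≤-trans 0<p (m≤m+n p q₂))
          (ear+arc⇒closedTrail (Ear-reverse ear) 0<p 0<q₂ q₂<len (trans πp≡j (sym i→j))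
            (trans (cong π (n∸n≡0 p)) π0≡i))
          even (+-≤-2* p≤M (≤-trans (<⇒≤ q₂<len) X≤M))

      module _ (Y : Cycle G) (oddY : Odd (Cycle.len Y)) (Y≤M : Cycle.len Y ≤ M) where

        Touches : ℕ → Set
        Touches t = OnCycle X (at Y t)

        private
          d = Cycle.len Y

        -- Y leaves X at `start` and next returns at `end`: along an ear, or after all of Y if the vertex is the same.
        gap⇒⊥ : ∀ {lo k} → ¬ HasEdge G (Cycle.circuit X) (at Y k) (at Y (suc k)) →
                Gap {Touches} lo k (d + lo) → ⊥
        gap⇒⊥ {lo} {k} notEdge g = ¬¬-excluded-middle λ
          { (yes same) → figureEight⇒⊥ same
          ; (no differ) → ear⇒⊥ ear (m<n⇒0<n∸m a<b) (≤-trans p≤d Y≤M) P-start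
                            (subst Touches (sym [b∸a]+a≡b) P-end) (differ ∘ flip trans (cong (at Y) [b∸a]+a≡b))
          }
          where
          open Gap g renaming (start to a; end to b)
          a<b : a < b
          a<b = ≤-<-trans start≤k k<end
          [b∸a]+a≡b : b ∸ a + a ≡ b
          [b∸a]+a≡b = m∸n+n≡m (<⇒≤ a<b)
          p≤d : b ∸ a ≤ d
          p≤d = subst (b ∸ a ≤_) (m+n∸n≡m d a) (∸-monoˡ-≤ a (≤-trans end≤hi (+-monoʳ-≤ d lo≤start)))
          figureEight⇒⊥ : at Y a ≡ at Y b → ⊥
          figureEight⇒⊥ same with P-start
          ... | i , Ya≡Xi = noShortEvenClosedTrail z<s (figureEight Ya≡Xi apart) (odd+odd⇒even oddX oddY) (+-≤-2* X≤M Y≤M)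
            where
            apart : ∀ {t} → 0 < t → t < d → ¬ Touches (t + a)
            apart 0<t t<d = ¬P-between (m<n+m a 0<t) (<-≤-trans (+-monoˡ-< a t<d) (at-repeat⇒len≤ Y a<b same))
          ear : Ear X (b ∸ a) (atFrom Y a)
          ear = record
            { walk              = λ {r} _ → at-adj Y (r + a)
            ; interiorInjective = λ _ r<p _ r′<p → at-injective Y (<-≤-trans r<p p≤d) (<-≤-trans r′<p p≤d)
            ; interiorOff       = λ 0<r r<p → ¬P-between (m<n+m a 0<r) (subst (_ <_) [b∸a]+a≡b (+-monoˡ-< a r<p))
            ; notChord          = λ p≡1 → subst (λ x → ¬ HasEdge G (Cycle.circuit X) (at Y x) (at Y (suc x)))
                                    (sym (≤-antisym start≤k (s≤s⁻¹ (subst (k <_) (trans (sym [b∸a]+a≡b) (cong (_+ a) p≡1)) k<end))))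
                                    notEdge
            }

        edgeInWindow : ∀ {s₀ k} → s₀ < d → k < d → ¬ HasEdge G (Cycle.circuit X) (at Y k) (at Y (suc k)) →
                       ∃ λ k′ → s₀ ≤ k′ × k′ < d + s₀ × ¬ HasEdge G (Cycle.circuit X) (at Y k′) (at Y (suc k′))
        edgeInWindow {s₀} {k} s₀<d k<d notEdge with s₀ ≤? k
        ... | yes s₀≤k = k , s₀≤k , <-≤-trans k<d (m≤m+n d s₀) , notEdge
        ... | no  s₀≰k = d + k , ≤-trans (<⇒≤ s₀<d) (m≤m+n d k) , +-monoʳ-< d (≰⇒> s₀≰k) ,
                         notEdge ∘ subst₂ (HasEdge G (Cycle.circuit X)) (at-periodic Y k)
                                          (trans (cong (at Y) (sym (+-suc d k))) (at-periodic Y (suc k)))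

        notEdge⇒⊥ : ∀ {s₀ k} → s₀ < d → k < d → Touches s₀ →
                    ¬ HasEdge G (Cycle.circuit X) (at Y k) (at Y (suc k)) → ⊥
        notEdge⇒⊥ {s₀} s₀<d k<d touch@(m , Ys₀≡Xm) notEdge with edgeInWindow s₀<d k<d notEdge
        ... | k′ , s₀≤k′ , k′<d+s₀ , notEdge′ = ¬¬-decidableUpTo Touches (d + s₀) λ dec →
          gap⇒⊥ notEdge′ (gap dec s₀≤k′ k′<d+s₀ touch (m , trans (at-periodic Y s₀) Ys₀≡Xm))

        sharedVertex⇒edgeShared : ∀ {i j} → Cycle.vert X i ≡ Cycle.vert Y j →
                                  ∀ m → ¬ ¬ HasEdge G (Cycle.circuit X) (Cycle.vert Y m) (Cycle.vert Y (next m))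
        sharedVertex⇒edgeShared {i} {j} shared m notEdge =
          notEdge⇒⊥ (toℕ<n j) (toℕ<n m) (toℕ i , trans (at-toℕ Y j) (trans (sym shared) (sym (at-toℕ X i))))
            (notEdge ∘ subst₂ (HasEdge G (Cycle.circuit X)) (at-toℕ Y m) (at-suc-toℕ Y m))

  edgesShared⇒SameCycle : ∀ {C D : Cycle G} →
    (∀ m → HasEdge G (Cycle.circuit D) (Cycle.vert C m) (Cycle.vert C (next m))) →
    (∀ m → HasEdge G (Cycle.circuit C) (Cycle.vert D m) (Cycle.vert D (next m))) → SameCycle G C D
  edgesShared⇒SameCycle {C} {D} C⊆D D⊆C a b =
    mk⇔ (transfer {Cycle.circuit C} {Cycle.circuit D} C⊆D) (transfer {Cycle.circuit D} {Cycle.circuit C} D⊆C)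
    where
    transfer : ∀ {C D : Circuit G} → (∀ m → HasEdge G D (Circuit.vert C m) (Circuit.vert C (next m))) →
               HasEdge G C a b → HasEdge G D a b
    transfer C⊆D (m , e) with C⊆D m
    ... | m′ , e′ = m′ , SameEdge-trans e′ e

proposition3p4 : (M : ℕ) (G : SimpleGraph) → NoEvenCircuitsUpTo G (2 * M) →
    (C D : Cycle G) → Odd (Cycle.len C) → Cycle.len C ≤ M →
    Odd (Cycle.len D) → Cycle.len D ≤ M → ¬ SameCycle G C D →
    VertexDisjoint G C D
proposition3p4 M G noEven C D oddC C≤M oddD D≤M ¬same i j shared =
  ¬¬-∀-Fin (sharedVertex⇒edgeShared G M noEven C oddC C≤M D oddD D≤M shared) λ D⊆C →
  ¬¬-∀-Fin (sharedVertex⇒edgeShared G M noEven D oddD D≤M C oddC C≤M (sym shared)) λ C⊆D →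
  ¬same (edgesShared⇒SameCycle G {C} {D} C⊆D D⊆C)
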